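{- Let $k_1,k_2\ge 0$ be integers, $c_1=4k_1+3$, $c_2=4k_2+3$, and $m=c_1c_2-1$. Then every positive integer $p$ satisfying $p\equiv -c_1\pmod m$ or $p\equiv -c_2\pmod m$ is of the form $4k+1$ and admits positive integers $x,y,z$ with $$\frac{4}{p}=\frac{1}{x}+\frac{1}{y}+\frac{1}{z}.$$ -}

module Defs where

open import Data.Nat using (ℕ; _+_; _*_; _∸_; _<_)
open import Data.Nat.Divisibility using (_∣_)
open import Data.Product using (∃-syntax; _×_)
open import Relation.Binary.PropositionalEquality using (_≡_)

-- p ≡ -c (mod m), stated in ℕ as m ∣ p + c
_≡-neg_mod_ : ℕ → ℕ → ℕ → Set
p ≡-neg c mod m = m ∣ (p + c)

-- 4/p = 1/x + 1/y + 1/z with x,y,z positive, cleared of denominators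
-- (valid since p,x,y,z > 0): 4xyz = p(yz + xz + xy)
ErdosStraus : ℕ → Set
ErdosStraus p = ∃[ x ] ∃[ y ] ∃[ z ]
  (0 < x × 0 < y × 0 < z × 4 * x * y * z ≡ p * (y * z + x * z + x * y))

{-# OPTIONS --safe #-}
-- Write c = 4a + 3, d = 4b + 3 and cd = 1 + 4q. If p + c = 4nq then p ≡ 1 (mod 4), and
-- w = nd − 1 satisfies cw = p + n because c · nd = n (1 + 4q) = n + p + c. These two
-- relations give 4/p = 1/(nq) + 1/(nqw) + 1/(pqw). For p ≡ −d exchange c and d.
module Submission where

open import Defs
open import Data.List using ([]; _∷_)
open import Data.Nat using (ℕ; suc; zero; _+_; _*_; _∸_; _<_; z<s; >-nonZero; >-nonZero⁻¹)
open import Data.Nat.Properties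
  using (*-comm; *-identityʳ; *-distribˡ-∸; +-cancelʳ-≡; m+n∸n≡m; m+n∸m≡n; m≤m+n; m+n≡0⇒n≡0;
         <-≤-trans; m*n≢0⇒n≢0)
open import Data.Nat.Divisibility using (_∣_; divides; ∣-trans; m∣m*n; ∣m+n∣m⇒∣n)
open import Data.Nat.Tactic.RingSolver using (solve)
open import Data.Product using (∃-syntax; _×_; _,_)
open import Data.Sum using (_⊎_; inj₁; inj₂)
open import Relation.Nullary using (contradiction)
open import Relation.Binary.PropositionalEquality using (_≡_; sym; trans; cong; cong₂; subst; module ≡-Reasoning)

open ≡-Reasoning

m*n>0⇒n>0 : ∀ m {n} → 0 < m * n → 0 < n
m*n>0⇒n>0 m {n} m*n>0 = >-nonZero⁻¹ n {{m*n≢0⇒n≢0 m {{>-nonZero m*n>0}}}}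

m>0∧n>0⇒m*n>0 : ∀ {m n} → 0 < m → 0 < n → 0 < m * n
m>0∧n>0⇒m*n>0 {suc _} {suc _} _ _ = z<s

-- 4/p = 1/x + c/(px), and with x = nq the two conditions give
-- c/(px) = cqw/(pxqw) = (pq + x)/(pxqw) = 1/y + 1/z.
erdosStraus-of-identities : ∀ {p c n q w} → 0 < p →
  4 * (n * q) ≡ p + c → c * w ≡ p + n → ErdosStraus p
erdosStraus-of-identities {p} {c} {n} {q} {w} p>0 4x≡p+c cw≡p+n =
  x , y , z , x>0 , m>0∧n>0⇒m*n>0 x>0 w>0 ,
  m>0∧n>0⇒m*n>0 (m>0∧n>0⇒m*n>0 p>0 q>0) w>0 , identity
  where
  x y z : ℕ
  x = n * q
  y = x * w
  z = p * q * w

  x>0 : 0 < x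
  x>0 = m*n>0⇒n>0 4 (subst (0 <_) (sym 4x≡p+c) (<-≤-trans p>0 (m≤m+n p c)))

  q>0 : 0 < q
  q>0 = m*n>0⇒n>0 n x>0

  w>0 : 0 < w
  w>0 = m*n>0⇒n>0 c (subst (0 <_) (sym cw≡p+n) (<-≤-trans p>0 (m≤m+n p n)))

  4xqw≡pqw+pq+x : 4 * x * q * w ≡ p * q * w + p * q + x
  4xqw≡pqw+pq+x = begin
    4 * x * q * w             ≡⟨ cong (λ t → t * q * w) 4x≡p+c ⟩
    (p + c) * q * w           ≡⟨ solve (p ∷ c ∷ q ∷ w ∷ []) ⟩
    p * q * w + c * w * q     ≡⟨ cong (λ t → p * q * w + t * q) cw≡p+n ⟩
    p * q * w + (p + n) * q   ≡⟨ solve (p ∷ n ∷ q ∷ w ∷ []) ⟩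
    p * q * w + p * q + n * q ∎

  identity : 4 * x * y * z ≡ p * (y * z + x * z + x * y)
  identity = begin
    4 * (n * q) * (n * q * w) * (p * q * w)       ≡⟨ solve (n ∷ q ∷ w ∷ p ∷ []) ⟩
    p * (n * q) * w * (4 * (n * q) * q * w)       ≡⟨ cong (p * x * w *_) 4xqw≡pqw+pq+x ⟩
    p * (n * q) * w * (p * q * w + p * q + n * q) ≡⟨ solve (n ∷ q ∷ w ∷ p ∷ []) ⟩
    p * (n * q * w * (p * q * w) + n * q * (p * q * w) + n * q * (n * q * w)) ∎

erdosStraus-of-≡-neg : ∀ {p c d q} → 0 < p →
  c * d ≡ 1 + 4 * q → p ≡-neg c mod (4 * q) → ErdosStraus p
erdosStraus-of-≡-neg {p} {c} {d} {q} p>0 cd≡1+4q (divides n p+c≡n*4q) =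
  erdosStraus-of-identities p>0 4nq≡p+c c[nd∸1]≡p+n
  where
  4nq≡p+c : 4 * (n * q) ≡ p + c
  4nq≡p+c = begin
    4 * (n * q) ≡⟨ solve (n ∷ q ∷ []) ⟩
    n * (4 * q) ≡⟨ sym p+c≡n*4q ⟩
    p + c       ∎

  cnd≡p+n+c : c * (n * d) ≡ p + n + c
  cnd≡p+n+c = begin
    c * (n * d)       ≡⟨ solve (c ∷ n ∷ d ∷ []) ⟩
    n * (c * d)       ≡⟨ cong (n *_) cd≡1+4q ⟩
    n * (1 + 4 * q)   ≡⟨ solve (n ∷ q ∷ []) ⟩
    n + n * (4 * q)   ≡⟨ cong (n +_) (sym p+c≡n*4q) ⟩
    n + (p + c)       ≡⟨ solve (n ∷ p ∷ c ∷ []) ⟩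
    p + n + c         ∎

  c[nd∸1]≡p+n : c * (n * d ∸ 1) ≡ p + n
  c[nd∸1]≡p+n = begin
    c * (n * d ∸ 1)     ≡⟨ *-distribˡ-∸ c (n * d) 1 ⟩
    c * (n * d) ∸ c * 1 ≡⟨ cong₂ _∸_ cnd≡p+n+c (*-identityʳ c) ⟩
    p + n + c ∸ c       ≡⟨ m+n∸n≡m (p + n) c ⟩
    p + n               ∎

≡-neg3mod4⇒≡4k+1 : ∀ {p} → p ≡-neg 3 mod 4 → ∃[ k ] p ≡ 4 * k + 1
≡-neg3mod4⇒≡4k+1 {p} (divides zero p+3≡0) = contradiction (m+n≡0⇒n≡0 p p+3≡0) λ ()
≡-neg3mod4⇒≡4k+1 {p} (divides (suc k) p+3≡[1+k]*4) =
  k , +-cancelʳ-≡ 3 p (4 * k + 1) (trans p+3≡[1+k]*4 (solve (k ∷ [])))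

≡-neg[4a+3]mod4⇒≡4k+1 : ∀ {p} a → p ≡-neg (4 * a + 3) mod 4 → ∃[ k ] p ≡ 4 * k + 1
≡-neg[4a+3]mod4⇒≡4k+1 {p} a 4∣p+4a+3 = ≡-neg3mod4⇒≡4k+1
  (∣m+n∣m⇒∣n (subst (4 ∣_) regroup 4∣p+4a+3) (m∣m*n a))
  where
  regroup : p + (4 * a + 3) ≡ 4 * a + (p + 3)
  regroup = solve (p ∷ a ∷ [])

≡1mod4×erdosStraus : ∀ {p d} a q → 0 < p → (4 * a + 3) * d ≡ 1 + 4 * q →
  p ≡-neg (4 * a + 3) mod ((4 * a + 3) * d ∸ 1) →
  (∃[ k ] p ≡ 4 * k + 1) × ErdosStraus p
≡1mod4×erdosStraus {p} {d} a q p>0 cd≡1+4q p≡-c =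
  ≡-neg[4a+3]mod4⇒≡4k+1 a (∣-trans (m∣m*n q) p≡-c[4q]) ,
  erdosStraus-of-≡-neg {q = q} p>0 cd≡1+4q p≡-c[4q]
  where
  p≡-c[4q] : p ≡-neg (4 * a + 3) mod (4 * q)
  p≡-c[4q] = subst (p ≡-neg (4 * a + 3) mod_)
    (trans (cong (_∸ 1) cd≡1+4q) (m+n∸m≡n 1 (4 * q))) p≡-c

quarter : ℕ → ℕ → ℕ
quarter a b = 4 * a * b + 3 * a + 3 * b + 2

[4a+3][4b+3]≡1+4*quarter : ∀ a b → (4 * a + 3) * (4 * b + 3) ≡ 1 + 4 * quarter a b
[4a+3][4b+3]≡1+4*quarter a b = begin
  (4 * a + 3) * (4 * b + 3)               ≡⟨ solve (a ∷ b ∷ []) ⟩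
  1 + 4 * (4 * a * b + 3 * a + 3 * b + 2) ∎

theorem2p5 : (k₁ k₂ p : ℕ) → 0 < p →
    (p ≡-neg (4 * k₁ + 3) mod ((4 * k₁ + 3) * (4 * k₂ + 3) ∸ 1)
      ⊎ p ≡-neg (4 * k₂ + 3) mod ((4 * k₁ + 3) * (4 * k₂ + 3) ∸ 1)) →
    (∃[ k ] p ≡ 4 * k + 1) × ErdosStraus p
theorem2p5 k₁ k₂ p p>0 (inj₁ p≡-c₁) =
  ≡1mod4×erdosStraus k₁ (quarter k₁ k₂) p>0 ([4a+3][4b+3]≡1+4*quarter k₁ k₂) p≡-c₁
theorem2p5 k₁ k₂ p p>0 (inj₂ p≡-c₂) =
  ≡1mod4×erdosStraus k₂ (quarter k₂ k₁) p>0 ([4a+3][4b+3]≡1+4*quarter k₂ k₁)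
    (subst (λ m → p ≡-neg (4 * k₂ + 3) mod (m ∸ 1)) (*-comm (4 * k₁ + 3) (4 * k₂ + 3)) p≡-c₂)
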